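{- Let $P,Q$ be integers with $Q\ne0$, $U=U(P,Q)$, $V=V(P,Q)$. Let $p$ be an odd prime with $p\nmid Q$ whose rank of appearance $\rho$ in $U$ is even, and let $k\ge1$ be an odd integer. Then $$\frac{V_{k\rho}}{2}\equiv -Q^{k\rho/2}\pmod{p^2}.$$
   Context: For integers $P,Q$ with $Q\ne0$, $U(P,Q)$ is given by $U_0=0$, $U_1=1$, $U_{n+2}=PU_{n+1}-QU_n$, and $V(P,Q)$ by the same recurrence with $V_0=2$, $V_1=P$. The rank of appearance of a prime $p$ in $U$ is the least positive integer $t$ with $p\mid U_t$. The congruence is understood $p$-adically ($2$ is invertible modulo $p$). -}

module Defs where

open import Data.Nat using (ℕ; zero; suc; _<_)
open import Data.Integer using (ℤ; +_; _+_; _-_; _*_)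
open import Data.Integer.Divisibility using (_∣_)
open import Data.Product using (_×_)
open import Relation.Nullary using (¬_)

U : ℤ → ℤ → ℕ → ℤ
U P Q zero = + 0
U P Q (suc zero) = + 1
U P Q (suc (suc n)) = P * U P Q (suc n) - Q * U P Q n

V : ℤ → ℤ → ℕ → ℤ
V P Q zero = + 2
V P Q (suc zero) = P
V P Q (suc (suc n)) = P * V P Q (suc n) - Q * V P Q n

IsRankOfAppearance : ℤ → ℤ → ℕ → ℕ → Set
IsRankOfAppearance P Q p ρ =
  (0 < ρ) × ((+ p) ∣ U P Q ρ) × (∀ t → 0 < t → t < ρ → ¬ ((+ p) ∣ U P Q t))

{-# OPTIONS --safe #-}
module Submission where

open import Defs
open import Data.Nat using (ℕ; suc; _*_)
open import Data.Nat.Primality using (Prime)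
open import Data.Integer using (ℤ; +_; _+_; _^_) renaming (_*_ to _*ℤ_)
open import Data.Integer.Divisibility using (_∣_)
open import Relation.Nullary using (¬_)
open import Relation.Binary.PropositionalEquality using (_≢_)

import Data.Nat as ℕ
import Data.Nat.Properties as ℕ
import Data.Nat.Divisibility as ℕ
import Data.Nat.Tactic.RingSolver as ℕ-Solver
open import Data.Nat.Primality using (euclidsLemma)
open import Data.Integer using (_-_; ∣_∣)
open import Data.Integer.Properties using (abs-*; *-comm; *-zeroʳ; +-identityʳ)
import Data.Integer.Divisibility.Signed as Signed
open import Data.Integer.Tactic.RingSolver using (solve-∀)
open import Data.Product using (_,_)
open import Data.Sum using (inj₁; inj₂)
open import Data.Empty using (⊥-elim)
open import Relation.Binary.PropositionalEquality
  using (_≡_; refl; sym; trans; cong; cong₂; subst; subst₂; module ≡-Reasoning)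

-- Every sequence W obeying the recurrence of U(P,Q) satisfies W_{n+2m} + Q^m W_n = V_m W_{n+m}.
-- For W = U and n = 0 this is U_{2m} = V_m U_m, so p ∣ V_m when 2m is the rank of appearance
-- of p, by minimality. For W = V it shows that V_m divides V_{km} for odd k, and, with n = 0,
-- that V_{2M} + 2Q^M = V_M², which is then divisible by p².

LucasRecurrence : ℤ → ℤ → (ℕ → ℤ) → Set
LucasRecurrence P Q W = ∀ n → W (suc (suc n)) ≡ P *ℤ W (suc n) - Q *ℤ W n

private
  shift-by-one : ∀ P Q a b → P *ℤ a - Q *ℤ b + Q *ℤ + 1 *ℤ b ≡ P *ℤ a
  shift-by-one = solve-∀

  double-self : ∀ x → x + + 1 *ℤ x ≡ + 2 *ℤ x
  double-self = solve-∀

  +-exchange : ∀ k n m → n ℕ.+ (k ℕ.+ m) ≡ k ℕ.+ (n ℕ.+ m)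
  +-exchange = ℕ-Solver.solve-∀

  +-exchange-double : ∀ k n m → n ℕ.+ 2 * (k ℕ.+ m) ≡ 2 * k ℕ.+ (n ℕ.+ 2 * m)
  +-exchange-double = ℕ-Solver.solve-∀

  next-odd-multiple : ∀ j m → suc (2 * suc j) * m ≡ suc (2 * j) * m ℕ.+ 2 * m
  next-odd-multiple = ℕ-Solver.solve-∀

-- P times the first identity minus Q times the second; the recurrence is applied at both ends.
recurrence-combine : ∀ P Q {x₂ x₁ x₀ y₂ y₁ y₀} q a b c →
  x₂ ≡ P *ℤ x₁ - Q *ℤ x₀ → y₂ ≡ P *ℤ y₁ - Q *ℤ y₀ →
  x₁ + Q *ℤ q *ℤ y₁ ≡ a *ℤ c → x₀ + q *ℤ y₂ ≡ b *ℤ c →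
  x₂ + Q *ℤ (Q *ℤ q) *ℤ y₀ ≡ (P *ℤ a - Q *ℤ b) *ℤ c
recurrence-combine P Q {x₁ = x₁} {x₀} {y₁ = y₁} {y₀} q a b c refl refl ih₁ ih₀ = trans
  (combine P Q x₁ x₀ y₁ y₀ q)
  (trans (cong₂ (λ s t → P *ℤ s - Q *ℤ t) ih₁ ih₀) (factor P Q a b c))
  where
  combine : ∀ P Q x₁ x₀ y₁ y₀ q →
    P *ℤ x₁ - Q *ℤ x₀ + Q *ℤ (Q *ℤ q) *ℤ y₀ ≡
    P *ℤ (x₁ + Q *ℤ q *ℤ y₁) - Q *ℤ (x₀ + q *ℤ (P *ℤ y₁ - Q *ℤ y₀))
  combine = solve-∀
  factor : ∀ P Q a b c → P *ℤ (a *ℤ c) - Q *ℤ (b *ℤ c) ≡ (P *ℤ a - Q *ℤ b) *ℤ c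
  factor = solve-∀

V-shift-step : ∀ P Q W → LucasRecurrence P Q W → ∀ m n →
  W (suc n ℕ.+ 2 * suc m) + Q ^ suc m *ℤ W (suc n) ≡ V P Q (suc m) *ℤ W (suc n ℕ.+ suc m) →
  W (suc (suc n) ℕ.+ 2 * m) + Q ^ m *ℤ W (suc (suc n)) ≡ V P Q m *ℤ W (suc (suc n) ℕ.+ m) →
  W (n ℕ.+ 2 * suc (suc m)) + Q ^ suc (suc m) *ℤ W n ≡ V P Q (suc (suc m)) *ℤ W (n ℕ.+ suc (suc m))
V-shift-step P Q W rec m n ih₁ ih₀ =
  subst₂ (λ i j → W i + Q ^ suc (suc m) *ℤ W n ≡ V P Q (suc (suc m)) *ℤ W j)
    (sym (+-exchange-double 2 n m)) (sym (+-exchange 2 n m))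
    (recurrence-combine P Q (Q ^ m) (V P Q (suc m)) (V P Q m) (W (2 ℕ.+ (n ℕ.+ m)))
      (rec _) (rec n) ih₁′ ih₀)
  where
  ih₁′ : W (3 ℕ.+ (n ℕ.+ 2 * m)) + Q ^ suc m *ℤ W (suc n) ≡ V P Q (suc m) *ℤ W (2 ℕ.+ (n ℕ.+ m))
  ih₁′ = subst₂ (λ i j → W i + Q ^ suc m *ℤ W (suc n) ≡ V P Q (suc m) *ℤ W j)
    (cong suc (+-exchange-double 1 n m)) (cong suc (+-exchange 1 n m)) ih₁

V-shift : ∀ P Q W → LucasRecurrence P Q W →
  ∀ m n → W (n ℕ.+ 2 * m) + Q ^ m *ℤ W n ≡ V P Q m *ℤ W (n ℕ.+ m)
V-shift P Q W rec ℕ.zero n rewrite ℕ.+-identityʳ n = double-self (W n)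
V-shift P Q W rec (suc ℕ.zero) n rewrite ℕ.+-comm n 2 | ℕ.+-comm n 1 | rec n =
  shift-by-one P Q (W (suc n)) (W n)
V-shift P Q W rec (suc (suc m)) n = V-shift-step P Q W rec m n
  (V-shift P Q W rec (suc m) (suc n)) (V-shift P Q W rec m (suc (suc n)))

U-double : ∀ P Q m → U P Q (2 * m) ≡ V P Q m *ℤ U P Q m
U-double P Q m = begin
  U P Q (2 * m)                          ≡⟨ +-identityʳ _ ⟨
  U P Q (2 * m) + + 0                    ≡⟨ cong (λ x → U P Q (2 * m) + x) (*-zeroʳ (Q ^ m)) ⟨
  U P Q (2 * m) + Q ^ m *ℤ U P Q 0       ≡⟨ V-shift P Q (U P Q) (λ _ → refl) m 0 ⟩
  V P Q m *ℤ U P Q m                     ∎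
  where open ≡-Reasoning

V-double : ∀ P Q m → V P Q (2 * m) + + 2 *ℤ Q ^ m ≡ V P Q m *ℤ V P Q m
V-double P Q m = trans (cong (λ x → V P Q (2 * m) + x) (*-comm (+ 2) (Q ^ m)))
  (V-shift P Q (V P Q) (λ _ → refl) m 0)

V∣V-odd-multiple : ∀ P Q m j → V P Q m Signed.∣ V P Q (suc (2 * j) * m)
V∣V-odd-multiple P Q m ℕ.zero rewrite ℕ.+-identityʳ m = Signed.∣-refl
V∣V-odd-multiple P Q m (suc j) = Signed.∣m+n∣n⇒∣m Vₘ∣sum
  (Signed.∣n⇒∣m*n (Q ^ m) (V∣V-odd-multiple P Q m j))
  where
  n = suc (2 * j) * m
  Vₘ∣sum : V P Q m Signed.∣ V P Q (suc (2 * suc j) * m) + Q ^ m *ℤ V P Q n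
  Vₘ∣sum rewrite next-odd-multiple j m | V-shift P Q (V P Q) (λ _ → refl) m n =
    Signed.∣m⇒∣m*n _ Signed.∣-refl

p∣V-half-rank : ∀ P Q p m → Prime p → IsRankOfAppearance P Q p (2 * m) → + p ∣ V P Q m
p∣V-half-rank P Q p (suc k) p-prime (_ , p∣U₂ₘ , minimal)
  with euclidsLemma ∣ V P Q (suc k) ∣ ∣ U P Q (suc k) ∣ p-prime p∣VₘUₘ
  where
  p∣VₘUₘ : p ℕ.∣ ∣ V P Q (suc k) ∣ * ∣ U P Q (suc k) ∣
  p∣VₘUₘ = subst (p ℕ.∣_) (abs-* (V P Q (suc k)) (U P Q (suc k)))
    (subst (λ x → + p ∣ x) (U-double P Q (suc k)) p∣U₂ₘ)
... | inj₁ p∣Vₘ = p∣Vₘ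
... | inj₂ p∣Uₘ = ⊥-elim (minimal (suc k) ℕ.z<s (ℕ.m<m+n (suc k) ℕ.z<s) p∣Uₘ)

∣⇒square∣square : ∀ {d} x → + d ∣ x → + (d * d) ∣ x *ℤ x
∣⇒square∣square {d} x d∣x = subst (d * d ℕ.∣_) (sym (abs-* x x)) (ℕ.*-pres-∣ d∣x d∣x)

lemma8 : (P Q : ℤ) → Q ≢ + 0 → (p : ℕ) → Prime p → p ≢ 2 → ¬ ((+ p) ∣ Q) →
    (m : ℕ) → IsRankOfAppearance P Q p (2 * m) →
    (j : ℕ) →
    (+ (p * p)) ∣ (V P Q ((suc (2 * j)) * (2 * m)) + (+ 2) *ℤ (Q ^ ((suc (2 * j)) * m)))
lemma8 P Q _ p p-prime _ _ m rank j =
  subst (+ (p * p) ∣_) (sym V-identity) (∣⇒square∣square (V P Q M) p∣V)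
  where
  M = suc (2 * j) * m
  p∣V : + p ∣ V P Q M
  p∣V = Signed.∣⇒∣ᵤ (Signed.∣-trans (Signed.∣ᵤ⇒∣ {+ p} (p∣V-half-rank P Q p m p-prime rank))
    (V∣V-odd-multiple P Q m j))
  V-identity : V P Q (suc (2 * j) * (2 * m)) + + 2 *ℤ Q ^ M ≡ V P Q M *ℤ V P Q M
  V-identity rewrite ℕ.*-comm (suc (2 * j)) (2 * m) | ℕ.*-assoc 2 m (suc (2 * j))
    | ℕ.*-comm m (suc (2 * j)) = V-double P Q M
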